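{- $\mathbf{GV}$ and $\mathbf{LV}$ have the same theorems.
   Context: Let $\mathcal L$ be the language of classical propositional logic $\{\land,\lor,\to,0,1\}$ over a denumerable set of variables, expanded with a binary connective $\mathbin{\Box\!\!\rightarrow}$ (the counterfactual conditional), with $\neg x := x\to 0$ and $x\leftrightarrow y := (x\to y)\land(y\to x)$. Consider the axioms: (L0) a Hilbert-style axiomatization of classical propositional logic; (L1) $\varphi\mathbin{\Box\!\!\rightarrow}\varphi$; (L2) $((\varphi\mathbin{\Box\!\!\rightarrow}\psi)\wedge(\psi\mathbin{\Box\!\!\rightarrow}\varphi))\to((\varphi\mathbin{\Box\!\!\rightarrow}\gamma)\leftrightarrow(\psi\mathbin{\Box\!\!\rightarrow}\gamma))$; (L3) $((\varphi\vee\psi)\mathbin{\Box\!\!\rightarrow}\varphi)\vee((\varphi\vee\psi)\mathbin{\Box\!\!\rightarrow}\psi)\vee(((\varphi\vee\psi)\mathbin{\Box\!\!\rightarrow}\gamma)\leftrightarrow((\varphi\mathbin{\Box\!\!\rightarrow}\gamma)\wedge(\psi\mathbin{\Box\!\!\rightarrow}\gamma)))$; (L4) $(\varphi\mathbin{\Box\!\!\rightarrow}(\psi\land\gamma))\leftrightarrow((\varphi\mathbin{\Box\!\!\rightarrow}\psi)\land(\varphi\mathbin{\Box\!\!\rightarrow}\gamma))$. The logic $\mathbf{GV}$ is the smallest finitary consequence relation containing (L0)–(L4) and satisfying modus ponens (MP) $\varphi,\varphi\to\psi\vdash\psi$ and the rule (C) $\varphi\to\psi\vdash(\gamma\mathbin{\Box\!\!\rightarrow}\varphi)\to(\gamma\mathbin{\Box\!\!\rightarrow}\psi)$.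 The logic $\mathbf{LV}$ is the smallest finitary consequence relation containing (L0)–(L4) and satisfying (MP) and the weak rule (wC): if $\vdash\varphi\to\psi$ then $\vdash(\gamma\mathbin{\Box\!\!\rightarrow}\varphi)\to(\gamma\mathbin{\Box\!\!\rightarrow}\psi)$. -}

module Defs where

open import Data.Nat using (ℕ)
open import Data.Empty using (⊥)

infixr 6 _∧_
infixr 5 _∨_
infixr 4 _⇒_
infixr 4 _□→_
infix 3 _⇔_

data Formula : Set where
  var  : ℕ → Formula
  _∧_  : Formula → Formula → Formula
  _∨_  : Formula → Formula → Formula
  _⇒_  : Formula → Formula → Formula
  ⊥′   : Formula
  ⊤′   : Formula
  _□→_ : Formula → Formula → Formula

¬′_ : Formula → Formula
¬′ x = x ⇒ ⊥′

_⇔_ : Formula → Formula → Formula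
x ⇔ y = (x ⇒ y) ∧ (y ⇒ x)

-- Axioms (L0)–(L4).  (L0) is a standard Hilbert-style axiomatization of
-- classical propositional logic for the connectives ∧, ∨, →, 0, 1
-- (instances range over all formulas of the expanded language).
data Axiom : Formula → Set where
  K    : ∀ φ ψ → Axiom (φ ⇒ (ψ ⇒ φ))
  S    : ∀ φ ψ χ → Axiom ((φ ⇒ (ψ ⇒ χ)) ⇒ ((φ ⇒ ψ) ⇒ (φ ⇒ χ)))
  ∧E₁  : ∀ φ ψ → Axiom ((φ ∧ ψ) ⇒ φ)
  ∧E₂  : ∀ φ ψ → Axiom ((φ ∧ ψ) ⇒ ψ)
  ∧I   : ∀ φ ψ → Axiom (φ ⇒ (ψ ⇒ (φ ∧ ψ)))
  ∨I₁  : ∀ φ ψ → Axiom (φ ⇒ (φ ∨ ψ))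
  ∨I₂  : ∀ φ ψ → Axiom (ψ ⇒ (φ ∨ ψ))
  ∨E   : ∀ φ ψ χ → Axiom ((φ ⇒ χ) ⇒ ((ψ ⇒ χ) ⇒ ((φ ∨ ψ) ⇒ χ)))
  ⊥E   : ∀ φ → Axiom (⊥′ ⇒ φ)
  ⊤I   : Axiom ⊤′
  DNE  : ∀ φ → Axiom (¬′ ¬′ φ ⇒ φ)
  L1   : ∀ φ → Axiom (φ □→ φ)
  L2   : ∀ φ ψ γ → Axiom (((φ □→ ψ) ∧ (ψ □→ φ)) ⇒ ((φ □→ γ) ⇔ (ψ □→ γ)))
  L3   : ∀ φ ψ γ → Axiom (((φ ∨ ψ) □→ φ) ∨ ((φ ∨ ψ) □→ ψ)
                          ∨ (((φ ∨ ψ) □→ γ) ⇔ ((φ □→ γ) ∧ (ψ □→ γ))))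
  L4   : ∀ φ ψ γ → Axiom ((φ □→ (ψ ∧ γ)) ⇔ ((φ □→ ψ) ∧ (φ □→ γ)))

Premises : Set₁
Premises = Formula → Set

∅ : Premises
∅ _ = ⊥

data GV (Γ : Premises) : Formula → Set where
  hyp : ∀ {φ} → Γ φ → GV Γ φ
  ax  : ∀ {φ} → Axiom φ → GV Γ φ
  mp  : ∀ {φ ψ} → GV Γ φ → GV Γ (φ ⇒ ψ) → GV Γ ψ
  C   : ∀ {φ ψ} γ → GV Γ (φ ⇒ ψ) → GV Γ ((γ □→ φ) ⇒ (γ □→ ψ))

data LV : Premises → Formula → Set₁ where
  hyp : ∀ {Γ φ} → Γ φ → LV Γ φ
  ax  : ∀ {Γ φ} → Axiom φ → LV Γ φ
  mp  : ∀ {Γ φ ψ} → LV Γ φ → LV Γ (φ ⇒ ψ) → LV Γ ψ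
  wC  : ∀ {Γ φ ψ} γ → LV ∅ (φ ⇒ ψ) → LV Γ ((γ □→ φ) ⇒ (γ □→ ψ))

⊢GV_ : Formula → Set
⊢GV φ = GV ∅ φ

⊢LV_ : Formula → Set₁
⊢LV φ = LV ∅ φ

{-# OPTIONS --safe #-}
module Submission where

open import Defs
open import Data.Product using (_×_; _,_)
open import Relation.Unary using (_⊆_)

GV-mono : ∀ {Γ Δ φ} → Γ ⊆ Δ → GV Γ φ → GV Δ φ
GV-mono Γ⊆Δ (hyp h)  = hyp (Γ⊆Δ h)
GV-mono Γ⊆Δ (ax a)   = ax a
GV-mono Γ⊆Δ (mp d e) = mp (GV-mono Γ⊆Δ d) (GV-mono Γ⊆Δ e)
GV-mono Γ⊆Δ (C γ d)  = C γ (GV-mono Γ⊆Δ d)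

LV⇒GV : ∀ {Γ φ} → LV Γ φ → GV Γ φ
LV⇒GV (hyp h)  = hyp h
LV⇒GV (ax a)   = ax a
LV⇒GV (mp d e) = mp (LV⇒GV d) (LV⇒GV e)
LV⇒GV (wC γ d) = C γ (GV-mono (λ ()) (LV⇒GV d))

⊢GV⇒⊢LV : ∀ {φ} → ⊢GV φ → ⊢LV φ
⊢GV⇒⊢LV (hyp ())
⊢GV⇒⊢LV (ax a)   = ax a
⊢GV⇒⊢LV (mp d e) = mp (⊢GV⇒⊢LV d) (⊢GV⇒⊢LV e)
⊢GV⇒⊢LV (C γ d)  = wC γ (⊢GV⇒⊢LV d)

theorem3p3 : (φ : Formula) → ((⊢GV φ → ⊢LV φ) × (⊢LV φ → ⊢GV φ))
theorem3p3 φ = ⊢GV⇒⊢LV , LV⇒GV
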